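{- Let $V$ be a finite set and $\mathcal{E},\mathcal{F}$ families of subsets of $V$. If $|\mathcal{I}(\mathcal{E})\cup\mathcal{I}(\mathcal{F})|<2^{|V|-1}$, then $\langle V,\mathcal{E},\mathcal{F}\rangle$ has Property S.
   Context: For a family $\mathcal{A}$ of subsets of $V$, $\mathcal{I}(\mathcal{A})=\{v\subseteq V : v\supseteq a \text{ for some } a\in\mathcal{A}\}$, the collection of subsets of $V$ containing some member of $\mathcal{A}$. A set $X$ is a transversal for a family $\mathcal{A}$ if $X\cap A\neq\emptyset$ for every $A\in\mathcal{A}$. $\langle V,\mathcal{E},\mathcal{F}\rangle$ has Property S if there is $X\subseteq V$ such that $X$ is a transversal for $\mathcal{E}$ and $V\setminus X$ is a transversal for $\mathcal{F}$. -}

module Defs where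

open import Data.Nat using (ℕ; zero; suc)
open import Data.Bool using (Bool; true; false)
open import Data.Vec using (Vec; []; _∷_)
open import Data.List using (List; []; _∷_; _++_; map; filter; length)
open import Data.List.Relation.Unary.Any using (Any)
open import Data.Fin.Subset using (Subset; _⊆_; _∩_; Nonempty)
open import Data.Fin.Subset.Properties using (_⊆?_; nonempty?)
open import Data.List.Relation.Unary.Any using (any?)
open import Data.Sum using (_⊎_)
open import Relation.Unary using (Decidable)
open import Relation.Nullary.Decidable using (_⊎-dec_)

-- The ground set V is Fin n; a subset of V is a Subset n (characteristic vector).
-- A family of subsets of V is a finite list of subsets (every family of subsets
-- of a finite set is finite; repetitions are harmless for everything below).

allSubsets : (n : ℕ) → List (Subset n)
allSubsets zero = [] ∷ []
allSubsets (suc n) =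
  map (true ∷_) (allSubsets n) ++ map (false ∷_) (allSubsets n)

InUpset : ∀ {n} → List (Subset n) → Subset n → Set
InUpset 𝒜 v = Any (λ a → a ⊆ v) 𝒜

inUpset? : ∀ {n} (𝒜 : List (Subset n)) → Decidable (InUpset 𝒜)
inUpset? 𝒜 v = any? (λ a → a ⊆? v) 𝒜

upsetUnion : ∀ {n} → List (Subset n) → List (Subset n) → List (Subset n)
upsetUnion {n} 𝓔 𝓕 =
  filter (λ v → inUpset? 𝓔 v ⊎-dec inUpset? 𝓕 v) (allSubsets n)

Transversal : ∀ {n} → Subset n → List (Subset n) → Set
Transversal X 𝒜 = ∀ {A} → Data.List.Membership.Propositional._∈_ A 𝒜 → Nonempty (X ∩ A)
  where import Data.List.Membership.Propositional

PropertyS : ∀ n → List (Subset n) → List (Subset n) → Set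
PropertyS n 𝓔 𝓕 =
  Data.Product.∃ λ (X : Subset n) → Transversal X 𝓔 Data.Product.× Transversal (Data.Fin.Subset.∁ X) 𝓕
  where import Data.Product
        import Data.Fin.Subset

-- If X fails Property S, then some member of 𝓔 lies inside ∁ X or some member of 𝓕
-- lies inside X, so X or ∁ X belongs to 𝓘(𝓔) ∪ 𝓘(𝓕); if Property S fails everywhere,
-- this union therefore meets all 2^(|V|-1) complementary pairs {X, ∁ X}.
-- Constructively the count runs the other way: a predicate with fewer than
-- 2^(|V|-1) members misses some pair {X, ∁ X}, found by fixing the first coordinate
-- and descending into a half of the cube that is still sparse.
module Submission where

open import Defs
open import Data.Nat using (ℕ; _<_; _^_; _∸_)
open import Data.List using (List; length)
open import Data.Fin.Subset using (Subset)

open import Data.Nat using (zero; suc; _+_; s≤s; z≤n)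
open import Data.Nat.Properties
  using (_<?_; ≮⇒≥; n<1⇒n≡0; ≤-<-trans; +-comm; +-identityʳ; +-monoˡ-≤; +-cancelˡ-<;
         +-commutativeSemigroup; module ≤-Reasoning)
open import Algebra.Properties.CommutativeSemigroup +-commutativeSemigroup using (interchange)
open import Data.Bool using (true; false; not)
open import Data.Vec using (_∷_; [])
open import Data.List using ([]; _∷_; _++_; map; filter)
open import Data.List.Properties using (filter-++; length-++)
import Data.List.Relation.Unary.Any as Any
open import Data.Fin.Subset using (_⊆_; _∩_; Nonempty; ∁)
open import Data.Fin.Subset.Properties using (nonempty?; x∈p∩q⁺; x∉p⇒x∈∁p; x∈∁p⇒x∉p; x∉∁p⇒x∈p; ⊆-refl)
open import Data.Product using (∃; _×_; _,_)
open import Data.Sum using (_⊎_; inj₁; inj₂; [_,_])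
open import Function using (_∘_)
open import Level using (Level)
open import Relation.Nullary using (¬_; yes; no)
open import Relation.Nullary.Decidable using (decidable-stable; _⊎-dec_)
open import Relation.Unary using (Pred; Decidable)
open import Relation.Binary.PropositionalEquality
  using (_≡_; refl; sym; trans; cong; cong₂; subst; module ≡-Reasoning)

private
  variable
    ℓ : Level

disjoint⇒⊆∁ : ∀ {n} {X A : Subset n} → ¬ Nonempty (X ∩ A) → A ⊆ ∁ X
disjoint⇒⊆∁ X∩A=∅ {x} x∈A = x∉p⇒x∈∁p λ x∈X → X∩A=∅ (x , x∈p∩q⁺ (x∈X , x∈A))

∁∁⊆ : ∀ {n} {X : Subset n} → ∁ (∁ X) ⊆ X
∁∁⊆ x∈∁∁X = x∉∁p⇒x∈p (x∈∁p⇒x∉p x∈∁∁X)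

transversal-of-∁⊆ : ∀ {n} {X Y : Subset n} (𝒜 : List (Subset n)) →
  ∁ X ⊆ Y → ¬ InUpset 𝒜 Y → Transversal X 𝒜
transversal-of-∁⊆ {X = X} 𝒜 ∁X⊆Y Y∉𝓘𝒜 {A} A∈𝒜 = decidable-stable (nonempty? (X ∩ A))
  λ X∩A=∅ → Y∉𝓘𝒜 (Any.map (λ { refl x∈A → ∁X⊆Y (disjoint⇒⊆∁ X∩A=∅ x∈A) }) A∈𝒜)

propertyS-of-pair∉upsets : ∀ {n} (𝓔 𝓕 : List (Subset n)) (X : Subset n) →
  ¬ InUpset 𝓔 (∁ X) → ¬ InUpset 𝓕 X → PropertyS n 𝓔 𝓕
propertyS-of-pair∉upsets 𝓔 𝓕 X ∁X∉𝓘𝓔 X∉𝓘𝓕 =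
  X , transversal-of-∁⊆ 𝓔 ⊆-refl ∁X∉𝓘𝓔 , transversal-of-∁⊆ 𝓕 ∁∁⊆ X∉𝓘𝓕

count : ∀ {m} {P : Pred (Subset m) ℓ} → Decidable P → ℕ
count {m = m} P? = length (filter P? (allSubsets m))

length-filter-map : ∀ {A B : Set} {P : Pred B ℓ} (P? : Decidable P) (f : A → B) (xs : List A) →
  length (filter P? (map f xs)) ≡ length (filter (P? ∘ f) xs)
length-filter-map P? f [] = refl
length-filter-map P? f (x ∷ xs) with P? (f x)
... | yes _ = cong suc (length-filter-map P? f xs)
... | no _ = length-filter-map P? f xs

count-suc : ∀ {m} {P : Pred (Subset (suc m)) ℓ} (P? : Decidable P) →
  count P? ≡ count (P? ∘ (true ∷_)) + count (P? ∘ (false ∷_))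
count-suc {m = m} P? = begin
  length (filter P? (map (true ∷_) all ++ map (false ∷_) all))
    ≡⟨ cong length (filter-++ P? (map (true ∷_) all) _) ⟩
  length (filter P? (map (true ∷_) all) ++ filter P? (map (false ∷_) all))
    ≡⟨ length-++ (filter P? (map (true ∷_) all)) ⟩
  length (filter P? (map (true ∷_) all)) + length (filter P? (map (false ∷_) all))
    ≡⟨ cong₂ _+_ (length-filter-map P? (true ∷_) all) (length-filter-map P? (false ∷_) all) ⟩
  count (P? ∘ (true ∷_)) + count (P? ∘ (false ∷_)) ∎
  where
    all = allSubsets m
    open ≡-Reasoning

+-<-double⇒< : ∀ {a b} k → a + b < k + k → a < k ⊎ b < k
+-<-double⇒< {a} {b} k a+b<k+k with a <? k
... | yes a<k = inj₁ a<k
... | no a≮k = inj₂ (+-cancelˡ-< k b k (≤-<-trans (+-monoˡ-≤ b (≮⇒≥ a≮k)) a+b<k+k))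

few⇒∃-pair-avoiding : ∀ m {P Q : Pred (Subset m) ℓ} (P? : Decidable P) (Q? : Decidable Q) →
  count P? + count Q? < 2 ^ m → ∃ λ Y → ¬ P Y × ¬ Q (∁ Y)
few⇒∃-pair-avoiding zero P? Q? few with P? [] | Q? []
... | no ¬p | no ¬q = [] , ¬p , ¬q
... | yes _ | _ with s≤s () ← few
... | no _ | yes _ with s≤s () ← few
few⇒∃-pair-avoiding (suc m) {P} {Q} P? Q? few =
  [ extend true , extend false ] (+-<-double⇒< (2 ^ m) (begin-strict
    (p₁ + q₀) + (p₀ + q₁)  ≡⟨ interchange p₁ q₀ p₀ q₁ ⟩
    (p₁ + p₀) + (q₀ + q₁)  ≡⟨ cong₂ _+_ (sym (count-suc P?)) (trans (+-comm q₀ q₁) (sym (count-suc Q?))) ⟩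
    count P? + count Q?    <⟨ few ⟩
    2 ^ m + (2 ^ m + 0)    ≡⟨ cong (2 ^ m +_) (+-identityʳ (2 ^ m)) ⟩
    2 ^ m + 2 ^ m          ∎))
  where
    open ≤-Reasoning
    p₁ p₀ q₁ q₀ : ℕ
    p₁ = count (P? ∘ (true ∷_))
    p₀ = count (P? ∘ (false ∷_))
    q₁ = count (Q? ∘ (true ∷_))
    q₀ = count (Q? ∘ (false ∷_))
    extend : ∀ b → count (P? ∘ (b ∷_)) + count (Q? ∘ (not b ∷_)) < 2 ^ m →
      ∃ λ Y → ¬ P Y × ¬ Q (∁ Y)
    extend b fewer with few⇒∃-pair-avoiding m (P? ∘ (b ∷_)) (Q? ∘ (not b ∷_)) fewer
    ... | Y , ¬p , ¬q = b ∷ Y , ¬p , ¬q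

few⇒∃-complement-pair-avoiding : ∀ n {P : Pred (Subset n) ℓ} (P? : Decidable P) →
  count P? < 2 ^ (n ∸ 1) → ∃ λ X → ¬ P X × ¬ P (∁ X)
few⇒∃-complement-pair-avoiding zero P? few =
  few⇒∃-pair-avoiding zero P? P? (subst (λ c → c + c < 1) (sym (n<1⇒n≡0 few)) (s≤s z≤n))
few⇒∃-complement-pair-avoiding (suc m) P? few
  with few⇒∃-pair-avoiding m (P? ∘ (true ∷_)) (P? ∘ (false ∷_)) (subst (_< 2 ^ m) (count-suc P?) few)
... | Y , ¬p , ¬q = true ∷ Y , ¬p , ¬q

theorem4 : (n : ℕ) (𝓔 𝓕 : List (Subset n)) →
    length (upsetUnion 𝓔 𝓕) < 2 ^ (n ∸ 1) →
    PropertyS n 𝓔 𝓕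
theorem4 n 𝓔 𝓕 few with few⇒∃-complement-pair-avoiding n (λ v → inUpset? 𝓔 v ⊎-dec inUpset? 𝓕 v) few
... | X , X∉𝓘 , ∁X∉𝓘 = propertyS-of-pair∉upsets 𝓔 𝓕 X (∁X∉𝓘 ∘ inj₁) (X∉𝓘 ∘ inj₂)
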